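{- For every even integer $n\ge 4$, $\chi'_L(K_n)=n+1$, where $K_n$ is the complete graph on $n$ vertices.
   Context: For a proper edge coloring $c:E(G)\to\{1,\dots,k\}$ of a connected graph $G$, let $\pi=(\mathcal{C}_1,\dots,\mathcal{C}_k)$ be the ordered partition of $E(G)$ into color classes. For a vertex $v$ and an edge $e=xy$, $d(v,e)=\min\{d(v,x),d(v,y)\}$, and $d(v,\mathcal{C}_i)=\min\{d(v,e): e\in\mathcal{C}_i\}$. The edge color code of $v$ is $c_\pi(v)=(d(v,\mathcal{C}_1),\dots,d(v,\mathcal{C}_k))$. The coloring $c$ is an edge-locating coloring if distinct vertices have distinct edge color codes; $\chi'_L(G)$ is the minimum $k$ for which $G$ has an edge-locating coloring with $k$ colors. -}

module Defs where

open import Data.Nat using (ℕ; zero; suc; _≤_; _⊓_)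
open import Data.Fin using (Fin)
open import Data.Product using (Σ; _×_; ∃; ∃-syntax)
open import Relation.Nullary using (¬_)
open import Relation.Binary.PropositionalEquality using (_≡_; _≢_)

record Graph (n : ℕ) : Set₁ where
  field
    Adj     : Fin n → Fin n → Set
    sym     : ∀ {x y} → Adj x y → Adj y x
    irrefl  : ∀ {x} → ¬ Adj x x
open Graph public

K : (n : ℕ) → Graph n
K n = record { Adj = λ x y → x ≢ y ; sym = λ p q → p (Relation.Binary.PropositionalEquality.sym q) ; irrefl = λ p → p Relation.Binary.PropositionalEquality.refl }

data Walk {n : ℕ} (G : Graph n) : Fin n → Fin n → ℕ → Set where
  here : ∀ {x} → Walk G x x zero
  step : ∀ {x y z m} → Adj G x y → Walk G y z m → Walk G x z (suc m)

IsDist : ∀ {n} → Graph n → Fin n → Fin n → ℕ → Set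
IsDist G u v m = Walk G u v m × (∀ m' → Walk G u v m' → m ≤ m')

Connected : ∀ {n} → Graph n → Set
Connected G = ∀ u v → ∃[ m ] Walk G u v m

record EdgeColoring {n : ℕ} (G : Graph n) (k : ℕ) : Set where
  field
    col     : (x y : Fin n) → Adj G x y → Fin k
    col-sym : ∀ x y (p : Adj G x y) (q : Adj G y x) → col x y p ≡ col y x q
open EdgeColoring public

Proper : ∀ {n k} {G : Graph n} → EdgeColoring G k → Set
Proper {G = G} c = ∀ x y z (p : Adj G x y) (q : Adj G x z) → y ≢ z → col c x y p ≢ col c x z q

-- Every color class C_i is nonempty (π is a partition into k classes).
AllColorsUsed : ∀ {n k} {G : Graph n} → EdgeColoring G k → Set
AllColorsUsed {n} {k} {G} c = ∀ (i : Fin k) → ∃[ x ] ∃[ y ] Σ (Adj G x y) λ p → col c x y p ≡ i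

EdgeDist : ∀ {n} → Graph n → Fin n → Fin n → Fin n → ℕ → Set
EdgeDist G v x y m = ∃[ m₁ ] ∃[ m₂ ] (IsDist G v x m₁ × IsDist G v y m₂ × m ≡ m₁ ⊓ m₂)

ClassDist : ∀ {n k} {G : Graph n} → EdgeColoring G k → Fin n → Fin k → ℕ → Set
ClassDist {n} {k} {G} c v i m =
  (∃[ x ] ∃[ y ] Σ (Adj G x y) λ p → col c x y p ≡ i × EdgeDist G v x y m)
  × (∀ x y (p : Adj G x y) m' → col c x y p ≡ i → EdgeDist G v x y m' → m ≤ m')

SameCode : ∀ {n k} {G : Graph n} → EdgeColoring G k → Fin n → Fin n → Set
SameCode {n} {k} c u v = ∀ (i : Fin k) m m' → ClassDist c u i m → ClassDist c v i m' → m ≡ m'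

IsEdgeLocating : ∀ {n k} {G : Graph n} → EdgeColoring G k → Set
IsEdgeLocating c = Proper c × AllColorsUsed c × (∀ u v → SameCode c u v → u ≡ v)

HasEdgeLocatingColoring : ∀ {n} → Graph n → ℕ → Set
HasEdgeLocatingColoring G k = Σ (EdgeColoring G k) IsEdgeLocating

EdgeLocatingChromaticIndex : ∀ {n} → Graph n → ℕ → Set
EdgeLocatingChromaticIndex G k =
  HasEdgeLocatingColoring G k × (∀ j → HasEdgeLocatingColoring G j → k ≤ j)

-- In K_n every vertex is at distance 0 or 1 from every colour class, so the
-- edge colour code of v records exactly the set of colours seen at v.
--
-- Lower bound: a proper colouring needs at least n − 1 colours. With n − 1
-- colours every vertex sees every colour. With n colours every vertex misses
-- exactly one colour; if the colouring is locating, the colour missing at one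
-- vertex is seen at all the others, so it is a perfect matching on the odd
-- number n − 1 of remaining vertices, which is impossible.
--
-- Upper bound: with N = n + 1 (odd) colours, take the vertices 0 … n − 2 of
-- Z_N with colour x + y, plus an apex joined to b by colour 2b, the colour b
-- would miss in K_N. Then b sees b, …, b + n − 2 and misses b − 1 and b − 2,
-- while the apex misses 2(n − 1) and 2n; these sets of missed colours are
-- pairwise distinct.
module Submission where

open import Defs hiding (sym)
open import Data.Empty using (⊥)
open import Data.Fin using (Fin; zero; suc; toℕ; fromℕ<; punchIn; punchOut; _≟_)
open import Data.Fin.Properties
  using (any?; ¬∀⟶∃¬; injective⇒≤; suc-injective; toℕ-injective; toℕ<n; toℕ-fromℕ<;
         punchIn-injective; punchInᵢ≢i; punchOut-injective; punchIn-punchOut)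
open import Data.Nat
  using (ℕ; zero; suc; _+_; _*_; _∸_; _%_; _/_; _≤_; _<_; NonZero; z≤n; s≤s; z<s; s≤s⁻¹)
open import Data.Nat.Coprimality using (Coprime; coprime-divisor)
open import Data.Nat.DivMod using (_mod_; m≡m%n+[m/n]*n; m<n⇒m%n≡m; [m+n]%n≡m%n)
open import Data.Nat.Divisibility
  using (_∣_; divides; _∣0; ∣-refl; ∣⇒≤; 0∣⇒≡0; ∣1⇒≡1; ∣m+n∣m⇒∣n; ∣m∣n⇒∣m+n)
open import Data.Nat.Properties
  using (≤-refl; <-≤-trans; ≤-<-trans; ≤-antisym; <⇒≤; <⇒≱; 1+n≰n; n≤1+n; m≤n+m;
         m≤n⇒m<n∨m≡n; <-cmp; +-comm; +-suc; +-identityʳ; ⊓-glb;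
         m∸n≤m; m∸n≡0⇒m≤n; m+[n∸m]≡n; [m+n]∸[m+o]≡n∸o; *-distribʳ-∸; *-distribˡ-∸;
         ∸-monoˡ-<; ∸-monoʳ-<; ≮⇒≥; _<?_) renaming (_≟_ to _≟ℕ_)
open import Data.Nat.Tactic.RingSolver using (solve-∀)
open import Data.Product using (Σ; ∃; ∃-syntax; _×_; _,_; proj₁; proj₂)
open import Data.Sum using (inj₁; inj₂)
open import Function using (_∘_; _⇔_; mk⇔; Equivalence)
open import Function.Definitions using (Injective)
open import Relation.Binary using (tri<; tri≈; tri>)
open import Relation.Binary.PropositionalEquality
  using (_≡_; _≢_; refl; sym; trans; cong; cong₂; subst; ≢-sym; module ≡-Reasoning)
open import Relation.Nullary using (¬_; Dec; yes; no; contradiction)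
import Relation.Nullary.Decidable as Dec

private variable
  d k m n o : ℕ

2∣n⇒¬2∣1+n : 2 ∣ n → ¬ 2 ∣ suc n
2∣n⇒¬2∣1+n {n} 2∣n 2∣1+n =
  contradiction (∣1⇒≡1 (∣m+n∣m⇒∣n (subst (2 ∣_) (+-comm 1 n) 2∣1+n) 2∣n)) λ ()

¬2∣⇒coprime-2 : ¬ 2 ∣ m → Coprime m 2
¬2∣⇒coprime-2 ¬2∣m {0}                   (_ , 0∣2)   = contradiction (0∣⇒≡0 0∣2) λ ()
¬2∣⇒coprime-2 ¬2∣m {1}                   _           = refl
¬2∣⇒coprime-2 ¬2∣m {2}                   (2∣m , _)   = contradiction 2∣m ¬2∣m
¬2∣⇒coprime-2 ¬2∣m {suc (suc (suc i))}   (_ , i∣2)   = contradiction (∣⇒≤ i∣2) λ { (s≤s (s≤s ())) }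

%≡%⇒∣∸ : ∀ m n d .{{_ : NonZero d}} → m % d ≡ n % d → d ∣ m ∸ n
%≡%⇒∣∸ m n d eq = divides (m / d ∸ n / d) (begin
  m ∸ n                                      ≡⟨ cong₂ _∸_ (m≡m%n+[m/n]*n m d) (m≡m%n+[m/n]*n n d) ⟩
  (m % d + m / d * d) ∸ (n % d + n / d * d)  ≡⟨ cong (λ r → (m % d + m / d * d) ∸ (r + n / d * d)) (sym eq) ⟩
  (m % d + m / d * d) ∸ (m % d + n / d * d)  ≡⟨ [m+n]∸[m+o]≡n∸o (m % d) _ _ ⟩
  m / d * d ∸ n / d * d                      ≡⟨ *-distribʳ-∸ d (m / d) (n / d) ⟨
  (m / d ∸ n / d) * d                        ∎)
  where open ≡-Reasoning

∣∸⇒≤ : m < d → d ∣ m ∸ n → m ≤ n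
∣∸⇒≤ {m} {d} {n} m<d d∣m∸n with m ∸ n in eq
... | zero  = m∸n≡0⇒m≤n eq
... | suc _ = contradiction (∣⇒≤ d∣m∸n) (<⇒≱ (subst (_< d) eq (≤-<-trans (m∸n≤m m n) m<d)))

+-cancelˡ-≡-mod : ∀ m .{{_ : NonZero d}} → n < d → o < d → (m + n) % d ≡ (m + o) % d → n ≡ o
+-cancelˡ-≡-mod {d} m n<d o<d eq = ≤-antisym (cancel n<d eq) (cancel o<d (sym eq))
  where
  cancel : ∀ {n o} → n < d → (m + n) % d ≡ (m + o) % d → n ≤ o
  cancel {n} {o} n<d eq = ∣∸⇒≤ n<d (subst (d ∣_) ([m+n]∸[m+o]≡n∸o m n o) (%≡%⇒∣∸ _ _ d eq))

+-double-injective-mod : .{{_ : NonZero d}} → Coprime d 2 →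
                         m < d → n < d → (m + m) % d ≡ (n + n) % d → m ≡ n
+-double-injective-mod {d} coprime m<d n<d eq = ≤-antisym (halve m<d eq) (halve n<d (sym eq))
  where
  m+m≡2*m : ∀ m → m + m ≡ 2 * m
  m+m≡2*m m = cong (m +_) (sym (+-identityʳ m))
  halve : ∀ {m n} → m < d → (m + m) % d ≡ (n + n) % d → m ≤ n
  halve {m} {n} m<d eq = ∣∸⇒≤ m<d (coprime-divisor coprime (subst (d ∣_) 2[m∸n] (%≡%⇒∣∸ _ _ d eq)))
    where
    2[m∸n] : (m + m) ∸ (n + n) ≡ 2 * (m ∸ n)
    2[m∸n] = trans (cong₂ _∸_ (m+m≡2*m m) (m+m≡2*m n)) (sym (*-distribˡ-∸ 2 m n))

toℕ-mod : ∀ s d .{{_ : NonZero d}} → toℕ (s mod d) ≡ s % d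
toℕ-mod s d = toℕ-fromℕ< _

mod-injective : ∀ s s′ d .{{_ : NonZero d}} → s mod d ≡ s′ mod d → s % d ≡ s′ % d
mod-injective s s′ d e = trans (sym (toℕ-mod s d)) (trans (cong toℕ e) (toℕ-mod s′ d))

injective⇒surjective : {f : Fin m → Fin m} → Injective _≡_ _≡_ f → ∀ i → ∃ λ t → f t ≡ i
injective⇒surjective {suc m} {f} f-injective i with any? (λ t → f t ≟ i)
... | yes hit = hit
... | no miss = contradiction (injective⇒≤ {f = g} g-injective) 1+n≰n
  where
  g : Fin (suc m) → Fin m
  g t = punchOut {i = i} {j = f t} (λ e → miss (t , sym e))
  g-injective : Injective _≡_ _≡_ g
  g-injective e = f-injective (punchOut-injective {i = i} _ _ e)

∃-∉-image : (f : Fin m → Fin (suc m)) → ∃ λ i → ¬ ∃ λ t → f t ≡ i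
∃-∉-image {m} f = ¬∀⟶∃¬ (suc m) _ (λ i → any? (λ t → f t ≟ i)) onto⇒⊥
  where
  onto⇒⊥ : (∀ i → ∃ λ t → f t ≡ i) → ⊥
  onto⇒⊥ onto = 1+n≰n (injective⇒≤ {f = proj₁ ∘ onto}
    (λ {i} {i′} e → trans (sym (proj₂ (onto i))) (trans (cong f e) (proj₂ (onto i′)))))

∉-image-unique : {f : Fin m → Fin (suc m)} → Injective _≡_ _≡_ f →
                 ∀ {i i′} → ¬ (∃ λ t → f t ≡ i) → ¬ (∃ λ t → f t ≡ i′) → i ≡ i′
∉-image-unique {m} {f} f-injective {i} {i′} i∉ i′∉ with i ≟ i′
... | yes i≡i′ = i≡i′
... | no  i≢i′ = contradiction (t , punchOut-injective _ i≢i′ gt≡) i′∉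
  where
  g : Fin m → Fin m
  g t = punchOut {i = i} {j = f t} (λ e → i∉ (t , sym e))
  g-onto = injective⇒surjective {f = g} (λ e → f-injective (punchOut-injective {i = i} _ _ e)) (punchOut i≢i′)
  t = proj₁ g-onto
  gt≡ = proj₂ g-onto

-- Deleting the 2-cycle {0, f 0} leaves a fixed-point-free involution f′.
fixedPointFree-involution⇒even : (f : Fin m → Fin m) →
                                 (∀ x → f x ≢ x) → (∀ x → f (f x) ≡ x) → 2 ∣ m
fixedPointFree-involution⇒even {zero} f _ _ = 2 ∣0
fixedPointFree-involution⇒even {suc zero} f fixed-free _ with f zero in eq
... | zero = contradiction eq (fixed-free zero)
fixedPointFree-involution⇒even {suc (suc m)} f fixed-free involutive with f zero in eq
... | zero  = contradiction eq (fixed-free zero)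
... | suc j = ∣m∣n⇒∣m+n ∣-refl
      (fixedPointFree-involution⇒even f′ f′-fixed-free f′-involutive)
  where
  embed : Fin m → Fin (suc (suc m))
  embed t = suc (punchIn j t)

  embed-injective : Injective _≡_ _≡_ embed
  embed-injective = punchIn-injective j _ _ ∘ suc-injective

  f∘embed≢0 : ∀ t → f (embed t) ≢ zero
  f∘embed≢0 t e = punchInᵢ≢i j t (suc-injective (trans (sym (involutive (embed t))) (trans (cong f e) eq)))

  f∘embed≢1+j : ∀ t → f (embed t) ≢ suc j
  f∘embed≢1+j t e = contradiction
    (trans (sym (involutive (embed t))) (trans (cong f e) (trans (cong f (sym eq)) (involutive zero)))) λ ()

  unembed : ∀ y → y ≢ zero → y ≢ suc j → ∃ λ t → embed t ≡ y
  unembed zero    y≢0 _      = contradiction refl y≢0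
  unembed (suc s) _   y≢1+j  = punchOut j≢s , cong suc (punchIn-punchOut j≢s)
    where
    j≢s : j ≢ s
    j≢s = y≢1+j ∘ cong suc ∘ sym

  restrict : ∀ t → ∃ λ t′ → embed t′ ≡ f (embed t)
  restrict t = unembed (f (embed t)) (f∘embed≢0 t) (f∘embed≢1+j t)

  f′ : Fin m → Fin m
  f′ = proj₁ ∘ restrict

  f′-fixed-free : ∀ t → f′ t ≢ t
  f′-fixed-free t e = fixed-free (embed t) (trans (sym (proj₂ (restrict t))) (cong embed e))

  f′-involutive : ∀ t → f′ (f′ t) ≡ t
  f′-involutive t = embed-injective (begin
    embed (f′ (f′ t))   ≡⟨ proj₂ (restrict (f′ t)) ⟩
    f (embed (f′ t))    ≡⟨ cong f (proj₂ (restrict t)) ⟩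
    f (f (embed t))     ≡⟨ involutive (embed t) ⟩
    embed t             ∎)
    where open ≡-Reasoning

module _ {n} {G : Graph n} where

  walk-≢⇒positive : ∀ {u v} → u ≢ v → Walk G u v m → 1 ≤ m
  walk-≢⇒positive u≢v here       = contradiction refl u≢v
  walk-≢⇒positive u≢v (step _ _) = s≤s z≤n

  isDist-refl : ∀ u → IsDist G u u 0
  isDist-refl u = here , λ _ _ → z≤n

  col-irrelevant : (c : EdgeColoring G k) → ∀ x y (p q : Adj G x y) → col c x y p ≡ col c x y q
  col-irrelevant c x y p q = trans (col-sym c x y p (Graph.sym G p)) (sym (col-sym c x y q (Graph.sym G p)))

  col-congʳ : (c : EdgeColoring G k) → ∀ x {y y′} → y ≡ y′ →
              (p : Adj G x y) (p′ : Adj G x y′) → col c x y p ≡ col c x y′ p′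
  col-congʳ c x refl = col-irrelevant c x _

  classDist-functional : (c : EdgeColoring G k) → ∀ {v i m m′} →
                         ClassDist c v i m → ClassDist c v i m′ → m ≡ m′
  classDist-functional c ((x , y , p , e , d) , least) ((x′ , y′ , p′ , e′ , d′) , least′) =
    ≤-antisym (least x′ y′ p′ _ e′ d′) (least′ x y p _ e d)

  SameCode-sym : (c : EdgeColoring G k) → ∀ {u v} → SameCode c u v → SameCode c v u
  SameCode-sym c same i m m′ cv cu = sym (same i m′ m cu cv)

isDist-≢ : ∀ {u v : Fin n} → u ≢ v → IsDist (K n) u v 1
isDist-≢ u≢v = step u≢v here , λ _ → walk-≢⇒positive u≢v

module _ {n k} (c : EdgeColoring (K n) k) where

  Sees : Fin n → Fin k → Set
  Sees v i = ∃[ y ] Σ (v ≢ y) λ p → col c v y p ≡ i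

  Separates : Fin n → Fin n → Set
  Separates u v = ∃ λ i → Sees u i × ¬ Sees v i

  sees? : ∀ v i → Dec (Sees v i)
  sees? v i = any? colour-i?
    where
    colour-i? : ∀ y → Dec (Σ (v ≢ y) λ p → col c v y p ≡ i)
    colour-i? y with v ≟ y
    ... | yes refl = no λ (p , _) → p refl
    ... | no v≢y   = Dec.map′ (v≢y ,_) (λ (p , e) → trans (col-irrelevant c v y v≢y p) e)
                               (col c v y v≢y ≟ i)

  sees-right : ∀ {x y i} (p : x ≢ y) → col c x y p ≡ i → Sees y i
  sees-right {x} {y} p e = x , ≢-sym p , trans (sym (col-sym c x y p (≢-sym p))) e

  unseen⇒not-endpoint : ∀ {v i x y} (p : x ≢ y) → ¬ Sees v i → col c x y p ≡ i → v ≢ x × v ≢ y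
  unseen⇒not-endpoint {y = y} p ¬sees e =
    (λ { refl → ¬sees (y , p , e) }) , (λ { refl → ¬sees (sees-right p e) })

  classDist-seen : ∀ {v i} → Sees v i → ClassDist c v i 0
  classDist-seen {v} (y , p , e) =
    (v , y , p , e , 0 , 1 , isDist-refl v , isDist-≢ p , refl) , λ _ _ _ _ _ _ → z≤n

  classDist-unseen : ∀ {v i x y} (p : x ≢ y) → ¬ Sees v i → col c x y p ≡ i → ClassDist c v i 1
  classDist-unseen {x = x} {y} p ¬sees e =
    (x , y , p , e , 1 , 1 , isDist-≢ v≢x , isDist-≢ v≢y , refl) , at-least-1
    where
    v≢x = proj₁ (unseen⇒not-endpoint p ¬sees e)
    v≢y = proj₂ (unseen⇒not-endpoint p ¬sees e)
    at-least-1 : ∀ x′ y′ (p′ : x′ ≢ y′) m → col c x′ y′ p′ ≡ _ → EdgeDist (K n) _ x′ y′ m → 1 ≤ m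
    at-least-1 x′ y′ p′ _ e′ (_ , _ , (w₁ , _) , (w₂ , _) , refl) =
      ⊓-glb (walk-≢⇒positive (proj₁ (unseen⇒not-endpoint p′ ¬sees e′)) w₁)
            (walk-≢⇒positive (proj₂ (unseen⇒not-endpoint p′ ¬sees e′)) w₂)

  sameSees⇒SameCode : ∀ {u v} → (∀ i → Sees u i ⇔ Sees v i) → SameCode c u v
  sameSees⇒SameCode {u} {v} same i m m′ cu cv with sees? u i | cu
  ... | yes seen  | _ = trans (classDist-functional c cu (classDist-seen seen))
                              (classDist-functional c (classDist-seen (Equivalence.to (same i) seen)) cv)
  ... | no unseen | (_ , _ , p , e , _) , _ =
          trans (classDist-functional c cu (classDist-unseen p unseen e))
                (classDist-functional c (classDist-unseen p (unseen ∘ Equivalence.from (same i)) e) cv)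

  separates⇒¬SameCode : AllColorsUsed c → ∀ {u v} → Separates u v → ¬ SameCode c u v
  separates⇒¬SameCode used (i , seen , unseen) same with used i
  ... | _ , _ , p , e = contradiction (same i 0 1 (classDist-seen seen) (classDist-unseen p unseen e)) λ ()

  proper⇒col-injective : Proper c → ∀ {x y z} (p : x ≢ y) (q : x ≢ z) → col c x y p ≡ col c x z q → y ≡ z
  proper⇒col-injective proper {x} {y} {z} p q e with y ≟ z
  ... | yes y≡z = y≡z
  ... | no y≢z  = contradiction e (proper x y z p q y≢z)

module _ {m k} (c : EdgeColoring (K (suc m)) k) where

  star : Fin (suc m) → Fin m → Fin k
  star v t = col c v (punchIn v t) (punchInᵢ≢i v t ∘ sym)

  sees⇔∈star : ∀ {v i} → Sees c v i ⇔ (∃ λ t → star v t ≡ i)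
  sees⇔∈star {v} = mk⇔
    (λ (y , p , e) → punchOut p , trans (col-congʳ c v (punchIn-punchOut p) _ p) e)
    (λ (t , e) → punchIn v t , _ , e)

  proper⇒star-injective : Proper c → ∀ v → Injective _≡_ _≡_ (star v)
  proper⇒star-injective proper v = punchIn-injective v _ _ ∘ proper⇒col-injective c proper _ _

  proper⇒degree≤colours : Proper c → m ≤ k
  proper⇒degree≤colours proper = injective⇒≤ (proper⇒star-injective proper zero)

proper⇒sees-all : (c : EdgeColoring (K (suc m)) m) → Proper c → ∀ v i → Sees c v i
proper⇒sees-all c proper v i =
  Equivalence.from (sees⇔∈star c) (injective⇒surjective (proper⇒star-injective c proper v) i)

¬edgeLocating-degree-colours : (c : EdgeColoring (K (suc (suc m))) (suc m)) → ¬ IsEdgeLocating c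
¬edgeLocating-degree-colours c (proper , _ , locating) = contradiction (locating zero (suc zero) same) λ ()
  where
  same : SameCode c zero (suc zero)
  same = sameSees⇒SameCode c λ i → mk⇔ (λ _ → proper⇒sees-all c proper (suc zero) i)
                                      (λ _ → proper⇒sees-all c proper zero i)

module _ {m} (c : EdgeColoring (K (suc m)) (suc m)) where

  ∃-unseen : ∀ v → ∃ λ i → ¬ Sees c v i
  ∃-unseen v with ∃-∉-image (star c v)
  ... | i , i∉star = i , i∉star ∘ Equivalence.to (sees⇔∈star c)

  proper⇒unseen-unique : Proper c → ∀ {v i i′} → ¬ Sees c v i → ¬ Sees c v i′ → i ≡ i′
  proper⇒unseen-unique proper {v} ¬i ¬i′ =
    ∉-image-unique (proper⇒star-injective c proper v)
      (¬i ∘ Equivalence.from (sees⇔∈star c)) (¬i′ ∘ Equivalence.from (sees⇔∈star c))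

  proper⇒sameUnseen⇒sameSees : Proper c → ∀ {u v i} → ¬ Sees c u i → ¬ Sees c v i →
                               ∀ i′ → Sees c u i′ ⇔ Sees c v i′
  proper⇒sameUnseen⇒sameSees proper {u} {v} ¬u ¬v i′ = mk⇔ (transfer ¬u ¬v) (transfer ¬v ¬u)
    where
    transfer : ∀ {x y i} → ¬ Sees c x i → ¬ Sees c y i → Sees c x i′ → Sees c y i′
    transfer {x} {y} ¬x ¬y seen with sees? c y i′
    ... | yes seen′ = seen′
    ... | no unseen = contradiction (subst (Sees c x) (proper⇒unseen-unique proper unseen ¬y) seen) ¬x

  edgeLocating⇒unseen-seenElsewhere : IsEdgeLocating c → ∀ {v w i} → v ≢ w → ¬ Sees c v i → Sees c w i
  edgeLocating⇒unseen-seenElsewhere (proper , _ , locating) {v} {w} {i} v≢w ¬v with sees? c w i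
  ... | yes seen  = seen
  ... | no unseen = contradiction
      (locating v w (sameSees⇒SameCode c (proper⇒sameUnseen⇒sameSees proper ¬v unseen))) v≢w

proper⇒perfectColourClass⇒even : (c : EdgeColoring (K m) k) → Proper c →
                                 ∀ i → (∀ v → Sees c v i) → 2 ∣ m
proper⇒perfectColourClass⇒even c proper i covered =
  fixedPointFree-involution⇒even partner (λ v → ≢-sym (proj₁ (proj₂ (covered v)))) involutive
  where
  partner : _ → _
  partner v = proj₁ (covered v)

  involutive : ∀ v → partner (partner v) ≡ v
  involutive v with covered v
  ... | y , v≢y , vy≡i with covered y
  ...   | z , y≢z , yz≡i = sym (proper⇒col-injective c proper (≢-sym v≢y) y≢z (begin
    col c y v (≢-sym v≢y)   ≡⟨ col-sym c y v (≢-sym v≢y) v≢y ⟩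
    col c v y v≢y           ≡⟨ vy≡i ⟩
    i                       ≡⟨ yz≡i ⟨
    col c y z y≢z           ∎))
    where open ≡-Reasoning

restrict : EdgeColoring (K (suc m)) k → EdgeColoring (K m) k
restrict c = record
  { col     = λ x y p → col c (suc x) (suc y) (p ∘ suc-injective)
  ; col-sym = λ x y p q → col-sym c (suc x) (suc y) _ _
  }

restrict-proper : (c : EdgeColoring (K (suc m)) k) → Proper c → Proper (restrict c)
restrict-proper c proper x y z p q y≢z = proper (suc x) (suc y) (suc z) _ _ (y≢z ∘ suc-injective)

restrict-sees : (c : EdgeColoring (K (suc m)) k) → ∀ {t i} →
                ¬ Sees c zero i → Sees c (suc t) i → Sees (restrict c) t i
restrict-sees c ¬sees₀ (zero  , p , e) = contradiction (sees-right c p e) ¬sees₀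
restrict-sees c ¬sees₀ (suc s , p , e) = s , p ∘ cong suc , trans (col-irrelevant c _ _ _ p) e

¬edgeLocating-order-colours : 2 ∣ suc m → (c : EdgeColoring (K (suc m)) (suc m)) → ¬ IsEdgeLocating c
¬edgeLocating-order-colours even c locating@(proper , _) with ∃-unseen c zero
... | i , ¬sees₀ = 2∣n⇒¬2∣1+n
  (proper⇒perfectColourClass⇒even (restrict c) (restrict-proper c proper) i
    (λ t → restrict-sees c ¬sees₀ (edgeLocating⇒unseen-seenElsewhere c locating (λ ()) ¬sees₀)))
  even

edgeLocating-lowerBound : ∀ {j} → 2 ∣ suc (suc m) →
                          HasEdgeLocatingColoring (K (suc (suc m))) j → suc (suc (suc m)) ≤ j
edgeLocating-lowerBound even (c , locating@(proper , _)) with m≤n⇒m<n∨m≡n (proper⇒degree≤colours c proper)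
... | inj₂ refl = contradiction locating (¬edgeLocating-degree-colours c)
... | inj₁ m+2≤j with m≤n⇒m<n∨m≡n m+2≤j
...   | inj₂ refl  = contradiction locating (¬edgeLocating-order-colours even c)
...   | inj₁ m+3≤j = m+3≤j

1+k+[5+k]≡[3+k]+[3+k] : ∀ k → suc k + (5 + k) ≡ 3 + k + (3 + k)
1+k+[5+k]≡[3+k]+[3+k] = solve-∀

module Construction (k : ℕ) (N-odd : ¬ 2 ∣ 5 + k) where

  n′ N : ℕ
  n′ = 3 + k
  N  = 2 + n′

  -- Vertex suc a stands for toℕ a ∈ Z_N; offset a y indexes its neighbours
  -- by 0 … n′ − 1, with the apex at offset toℕ a.
  offset : Fin n′ → Fin (suc n′) → ℕ
  offset a zero    = toℕ a
  offset a (suc b) = toℕ b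

  label : Fin (suc n′) → Fin (suc n′) → ℕ
  label zero    zero    = 0
  label zero    (suc b) = toℕ b + toℕ b
  label (suc a) y       = toℕ a + offset a y

  label-sym : ∀ x y → label x y ≡ label y x
  label-sym zero    zero    = refl
  label-sym zero    (suc b) = refl
  label-sym (suc a) zero    = refl
  label-sym (suc a) (suc b) = +-comm (toℕ a) (toℕ b)

  colouring : EdgeColoring (K (suc n′)) N
  colouring = record
    { col     = λ x y _ → label x y mod N
    ; col-sym = λ x y _ _ → cong (_mod N) (label-sym x y)
    }

  <n′⇒<N : o < n′ → o < N
  <n′⇒<N o<n′ = <-≤-trans o<n′ (m≤n+m n′ 2)

  coprime : Coprime N 2
  coprime = ¬2∣⇒coprime-2 N-odd

  offset<n′ : ∀ a y → offset a y < n′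
  offset<n′ a zero    = toℕ<n a
  offset<n′ a (suc b) = toℕ<n b

  offset-injective : ∀ a {y z} → suc a ≢ y → suc a ≢ z → offset a y ≡ offset a z → y ≡ z
  offset-injective a {zero}  {zero}  _ _ _ = refl
  offset-injective a {zero}  {suc b} _ q e = contradiction (cong suc (toℕ-injective e)) q
  offset-injective a {suc b} {zero}  p _ e = contradiction (cong suc (toℕ-injective (sym e))) p
  offset-injective a {suc b} {suc c} _ _ e = cong suc (toℕ-injective e)

  label-injective : ∀ x {y z} → x ≢ y → x ≢ z → label x y % N ≡ label x z % N → y ≡ z
  label-injective zero    {zero}          p _ _ = contradiction refl p
  label-injective zero    {_}     {zero}  _ q _ = contradiction refl q
  label-injective zero    {suc b} {suc c} _ _ e =
    cong suc (toℕ-injective (+-double-injective-mod coprime (<n′⇒<N (toℕ<n b)) (<n′⇒<N (toℕ<n c)) e))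
  label-injective (suc a) {y}     {z}     p q e = offset-injective a p q
    (+-cancelˡ-≡-mod (toℕ a) (<n′⇒<N (offset<n′ a y)) (<n′⇒<N (offset<n′ a z)) e)

  proper : Proper colouring
  proper x y z p q y≢z e = y≢z (label-injective x p q (mod-injective (label x y) (label x z) N e))

  neighbourAt : ∀ a → o < n′ → ∃ λ y → suc a ≢ y × offset a y ≡ o
  neighbourAt {o} a o<n′ with o ≟ℕ toℕ a
  ... | yes o≡a = zero , (λ ()) , sym o≡a
  ... | no  o≢a = suc (fromℕ< o<n′) , o≢a ∘ o≡a , toℕ-fromℕ< o<n′
    where
    o≡a : suc a ≡ suc (fromℕ< o<n′) → o ≡ toℕ a
    o≡a e = trans (sym (toℕ-fromℕ< o<n′)) (cong toℕ (sym (suc-injective e)))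

  sees-suc : ∀ a {i} → o < n′ → (toℕ a + o) % N ≡ toℕ i → Sees colouring (suc a) i
  sees-suc a o<n′ e with neighbourAt a o<n′
  ... | y , p , refl = y , p , toℕ-injective (trans (toℕ-mod (label (suc a) y) N) e)

  sees-suc-+N : ∀ a {s} → o < n′ → toℕ a + o + N ≡ s → Sees colouring (suc a) (s mod N)
  sees-suc-+N {o} a {s} o<n′ e =
    sees-suc a o<n′ (trans (sym ([m+n]%n≡m%n (toℕ a + o) N)) (trans (cong (_% N) e) (sym (toℕ-mod s N))))

  -- (b + n′ + 1) mod N is the colour b − 1.
  ¬sees-suc : ∀ b → ¬ Sees colouring (suc b) ((toℕ b + suc n′) mod N)
  ¬sees-suc b (y , _ , e) = 1+n≰n (<⇒≤ (subst (_< n′) offset≡1+n′ (offset<n′ b y)))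
    where
    offset≡1+n′ : offset b y ≡ suc n′
    offset≡1+n′ = +-cancelˡ-≡-mod (toℕ b) (<n′⇒<N (offset<n′ b y)) ≤-refl
                    (mod-injective (toℕ b + offset b y) (toℕ b + suc n′) N e)

  ¬sees-apex : ∀ {c} → n′ ≤ c → c < N → ¬ Sees colouring zero ((c + c) mod N)
  ¬sees-apex n′≤c c<N (zero  , p , _) = p refl
  ¬sees-apex {c} n′≤c c<N (suc b , _ , e) = <⇒≱ (toℕ<n b) (subst (n′ ≤_) (sym b≡c) n′≤c)
    where
    b≡c = +-double-injective-mod coprime (<n′⇒<N (toℕ<n b)) c<N
            (mod-injective (toℕ b + toℕ b) (c + c) N e)

  all-used : AllColorsUsed colouring
  all-used i with toℕ i <? 2
  ... | yes i<2 = suc zero , sees-suc zero (<-≤-trans i<2 (s≤s (s≤s z≤n))) (m<n⇒m%n≡m (toℕ<n i))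
  ... | no  i≮2 = suc (suc (suc zero)) , sees-suc (suc (suc zero)) (∸-monoˡ-< (toℕ<n i) 2≤i)
                    (trans (cong (_% N) (m+[n∸m]≡n 2≤i)) (m<n⇒m%n≡m (toℕ<n i)))
    where
    2≤i = ≮⇒≥ i≮2

  apex-separated : ∀ a → Separates colouring (suc a) zero
  apex-separated zero    = (n′ + n′) mod N ,
    sees-suc-+N zero (s≤s (s≤s (n≤1+n k))) (1+k+[5+k]≡[3+k]+[3+k] k) , ¬sees-apex ≤-refl (s≤s (n≤1+n n′))
  apex-separated (suc a) = (suc n′ + suc n′) mod N ,
    sees-suc-+N (suc a) (∸-monoʳ-< z<s 1+a≤n′)
      (trans (cong (_+ N) (m+[n∸m]≡n 1+a≤n′)) (+-suc n′ (suc n′))) ,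
    ¬sees-apex (n≤1+n n′) ≤-refl
    where
    1+a≤n′ = <⇒≤ (toℕ<n (suc a))

  distinct : ∀ {u v} → Separates colouring u v → ¬ SameCode colouring u v
  distinct = separates⇒¬SameCode colouring all-used

  suc-separated : ∀ a b → toℕ a < toℕ b → Separates colouring (suc a) (suc b)
  suc-separated a zero    ()
  suc-separated a (suc b) a<b = (toℕ (suc b) + suc n′) mod N ,
    sees-suc-+N a (≤-<-trans (m∸n≤m (toℕ b) (toℕ a)) (<⇒≤ (toℕ<n (suc b))))
      (trans (cong (_+ N) (m+[n∸m]≡n (s≤s⁻¹ a<b))) (+-suc (toℕ b) (suc n′))) ,
    ¬sees-suc (suc b)

  locating : ∀ u v → SameCode colouring u v → u ≡ v
  locating zero    zero    _    = refl
  locating zero    (suc a) same = contradiction (SameCode-sym colouring same) (distinct (apex-separated a))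
  locating (suc a) zero    same = contradiction same (distinct (apex-separated a))
  locating (suc a) (suc b) same with <-cmp (toℕ a) (toℕ b)
  ... | tri< a<b _ _ = contradiction same (distinct (suc-separated a b a<b))
  ... | tri≈ _ a≡b _ = cong suc (toℕ-injective a≡b)
  ... | tri> _ _ b<a = contradiction (SameCode-sym colouring same) (distinct (suc-separated b a b<a))

  edgeLocating : HasEdgeLocatingColoring (K (suc n′)) N
  edgeLocating = colouring , proper , all-used , locating

theorem8 : (n : ℕ) → 2 ∣ n → 4 ≤ n → EdgeLocatingChromaticIndex (K n) (suc n)
theorem8 (suc (suc (suc (suc k)))) even (s≤s (s≤s (s≤s (s≤s _)))) =
  Construction.edgeLocating k (2∣n⇒¬2∣1+n even) , λ _ → edgeLocating-lowerBound even
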